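{- Let $w = 3$ and $k \ge 2$ be integers, let $t = \lceil \frac{w+k}{2} \rceil$, and let $\Sigma$ be a totally ordered alphabet containing distinct letters $\mathtt{a},\mathtt{b}$. Let $T = (\mathtt{a}\mathtt{b})^t\mathtt{b}\mathtt{b}$ and $L = |T| = 2t+2$. Let $S \in \Sigma^n$ and $s$ be such that $S[s-2L \mathinner{.\,.} s+3L-1] = T^5$. Then the number of elements of $\mathcal{M}_{w,k}(S)$ in $[s, s+L-1]$ is $\lfloor k/2 \rfloor + 3$ if $\mathtt{a} < \mathtt{b}$, and $\lfloor k/2 \rfloor + 4$ if $\mathtt{b} < \mathtt{a}$.
   Context: Strings are 1-indexed; $X^q$ denotes the concatenation of $q$ copies of $X$. For a string $S$ of length $n$ over a totally ordered alphabet (order extended lexicographically to strings) and integers $w \ge 2$, $k \ge 1$: for each $i \in [1, n-w-k+2]$, the minimizer of the window $S[i\mathinner{.\,.} i+w+k-2]$ is the smallest position $j \in [i, i+w-1]$ such that $S[j\mathinner{.\,.} j+k-1]$ is lexicographically smallest among the fragments $S[j'\mathinner{.\,.} j'+k-1]$, $j' \in [i,i+w-1]$; $\mathcal{M}_{w,k}(S)$ is the set of all such minimizers. -}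

module Defs where

open import Level using (Level)
open import Data.Nat using (ℕ; zero; suc; _+_; _∸_; _≤_; _<_)
open import Data.List using (List; []; _∷_; _++_; take; drop; length; concat; replicate)
open import Data.List.Relation.Binary.Lex.Strict using (Lex-<)
open import Data.List.Membership.Propositional using (_∈_)
open import Data.List.Relation.Unary.Unique.Propositional using (Unique)
open import Data.Product using (Σ; _×_; ∃)
open import Relation.Binary.Core using (Rel)
open import Relation.Binary.PropositionalEquality using (_≡_)
open import Relation.Nullary using (¬_)
open import Function.Bundles using (_⇔_)

module Strings {a ℓ : Level} {A : Set a} (_≺_ : Rel A ℓ) where

  _^^_ : List A → ℕ → List A
  X ^^ q = concat (replicate q X)

  -- 1-indexed fragment S[i .. j]  (j ≥ i - 1)
  frag : List A → ℕ → ℕ → List A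
  frag S i j = take (suc j ∸ i) (drop (i ∸ 1) S)

  _<ₗ_ : Rel (List A) _
  _<ₗ_ = Lex-< _≡_ _≺_

  kmer : List A → ℕ → ℕ → List A
  kmer S k j = frag S j (j + k ∸ 1)

  IsSmallest : List A → ℕ → ℕ → ℕ → ℕ → Set _
  IsSmallest S w k i j =
    (i ≤ j × j ≤ i + w ∸ 1) ×
    (∀ j' → i ≤ j' → j' ≤ i + w ∸ 1 → ¬ (kmer S k j' <ₗ kmer S k j))

  -- j is the minimizer of the window S[i .. i+w+k-2]:
  -- the smallest position j in [i, i+w-1] with a lexicographically smallest k-mer
  IsMinimizerOf : List A → ℕ → ℕ → ℕ → ℕ → Set _
  IsMinimizerOf S w k i j =
    IsSmallest S w k i j × (∀ j' → j' < j → ¬ IsSmallest S w k i j')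

  InMinimizers : List A → ℕ → ℕ → ℕ → Set _
  InMinimizers S w k p =
    ∃ λ i → (1 ≤ i × i ≤ length S + 2 ∸ (w + k)) × IsMinimizerOf S w k i p

  CountInRange : List A → ℕ → ℕ → ℕ → ℕ → ℕ → Set _
  CountInRange S w k l r c =
    Σ (List ℕ) λ xs → Unique xs ×
      (∀ p → (p ∈ xs) ⇔ ((l ≤ p × p ≤ r) × InMinimizers S w k p)) ×
      length xs ≡ c

{-# OPTIONS --safe #-}
module Submission where

-- Around the block, S reads y y (xy)^t y y (xy)^t …, so with w = 3 the minimizer of
-- every window is decided by the first, second or third letters of its k-mers.  If
-- x < y, each x of the block wins the window centred on it, and the only other
-- minimizer is the last y of the run y y y, which wins the window formed by the run
-- (y x … < y y …).  If y < x, each y between two x's wins the window centred on it,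
-- and so do the three y's of the run: the first since y y y … ≤ y y x …, the second
-- since y y x … < y x …, and the third as the leftmost, because the k-mer two places
-- later only ties with it (k - 1 ≤ 2t - 2 letters of x y x … follow both).  Every
-- other position of the block has a strictly smaller k-mer on each side within
-- distance 3, so it wins no window.  This gives t + 1 resp. t + 2 minimizers, and
-- t = ⌊k/2⌋ + 2.

open import Defs
open import Level using (Level)
open import Data.Nat
  using (ℕ; zero; suc; _+_; _*_; _∸_; _≤_; _<_; _≤?_; z≤n; s≤s; z<s; s<s; ⌊_/2⌋; ⌈_/2⌉)
open import Data.Nat.Properties
open import Data.Nat.Tactic.RingSolver using (solve)
open import Data.List using (List; []; _∷_; _++_; length; take; drop; map; applyUpTo)
open import Data.List.Properties
  using (drop-drop; take++drop≡id; ++-assoc; length-++; length-map; length-applyUpTo)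
open import Data.List.Relation.Binary.Lex.Strict
  using (base; halt; this; next; <-irreflexive; <-asymmetric)
import Data.List.Relation.Binary.Pointwise.Properties as Pointwise
open import Data.List.Membership.Propositional using (_∈_)
open import Data.List.Membership.Propositional.Properties
  using (∈-map⁺; ∈-map⁻; ∈-applyUpTo⁺; ∈-applyUpTo⁻)
open import Data.List.Relation.Unary.Any using (here; there)
import Data.List.Relation.Unary.All as All
import Data.List.Relation.Unary.All.Properties as Allₚ
import Data.List.Relation.Unary.AllPairs as AllPairs
open import Data.List.Relation.Unary.Unique.Propositional using (Unique)
import Data.List.Relation.Unary.Unique.Propositional.Properties as Unique
open import Data.Product using (_×_; _,_; proj₂; ∃-syntax)
import Data.Product as Product
open import Data.Sum using (_⊎_; inj₁; inj₂)
open import Data.Empty using (⊥-elim)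
open import Function using (_∘_)
open import Function.Bundles using (mk⇔)
open import Relation.Binary.Core using (Rel)
open import Relation.Binary.Structures using (IsStrictPartialOrder; IsStrictTotalOrder)
open import Relation.Binary.Definitions using (tri<; tri≈; tri>)
open import Relation.Binary.PropositionalEquality
open import Relation.Nullary using (¬_; yes; no)

drop-suc : ∀ {a} {A : Set a} n {xs : List A} {u X} → drop n xs ≡ u ∷ X → drop (suc n) xs ≡ X
drop-suc zero    {_ ∷ _} refl = refl
drop-suc (suc n) {_ ∷ _} eq   = drop-suc n eq
drop-suc zero    {[]}    ()
drop-suc (suc n) {[]}    ()

drop-+ : ∀ {a} {A : Set a} d {n} {xs X : List A} → drop n xs ≡ X → drop (d + n) xs ≡ drop d X
drop-+ d {n} {xs} {X} eq = begin
  drop (d + n) xs     ≡⟨ cong (λ m → drop m xs) (+-comm d n) ⟩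
  drop (n + d) xs     ≡⟨ drop-drop n d xs ⟨
  drop d (drop n xs)  ≡⟨ cong (drop d) eq ⟩
  drop d X            ∎
  where open ≡-Reasoning

take≡⇒≡++drop : ∀ {a} {A : Set a} n {xs X : List A} → take n xs ≡ X → xs ≡ X ++ drop n xs
take≡⇒≡++drop n {xs} eq = trans (sym (take++drop≡id n xs)) (cong (_++ drop n xs) eq)

drop-length-++ : ∀ {a} {A : Set a} (P : List A) {Y} → drop (length P) (P ++ Y) ≡ Y
drop-length-++ []      = refl
drop-length-++ (_ ∷ P) = drop-length-++ P

≤3+2*t-cases : ∀ t n → n ≤ 3 + 2 * t →
  (∃[ j ] j ≤ t × n ≡ 2 * j) ⊎ (∃[ j ] j ≤ t × n ≡ 1 + 2 * j) ⊎
  n ≡ 2 + 2 * t ⊎ n ≡ 3 + 2 * t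
≤3+2*t-cases t       0 _ = inj₁ (0 , z≤n , refl)
≤3+2*t-cases t       1 _ = inj₂ (inj₁ (0 , z≤n , refl))
≤3+2*t-cases zero    2 _ = inj₂ (inj₂ (inj₁ refl))
≤3+2*t-cases zero    3 _ = inj₂ (inj₂ (inj₂ refl))
≤3+2*t-cases zero    (suc (suc (suc (suc n)))) (s≤s (s≤s (s≤s ())))
≤3+2*t-cases (suc t) (suc (suc n)) n≤
  with ≤3+2*t-cases t n (≤-pred (≤-pred (subst (suc (suc n) ≤_) (cong (3 +_) (*-suc 2 t)) n≤)))
... | inj₁ (j , j≤t , refl)         = inj₁ (suc j , s≤s j≤t , sym (*-suc 2 j))
... | inj₂ (inj₁ (j , j≤t , refl)) = inj₂ (inj₁ (suc j , s≤s j≤t , cong suc (sym (*-suc 2 j))))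
... | inj₂ (inj₂ (inj₁ refl))       = inj₂ (inj₂ (inj₁ (cong (2 +_) (sym (*-suc 2 t)))))
... | inj₂ (inj₂ (inj₂ refl))       = inj₂ (inj₂ (inj₂ (cong (3 +_) (sym (*-suc 2 t)))))

n<2*suc⌊n/2⌋ : ∀ n → n < 2 * suc ⌊ n /2⌋
n<2*suc⌊n/2⌋ zero          = z<s
n<2*suc⌊n/2⌋ (suc zero)    = s<s z<s
n<2*suc⌊n/2⌋ (suc (suc n)) =
  subst (suc (suc n) <_) (sym (*-suc 2 (suc ⌊ n /2⌋))) (s<s (s<s (n<2*suc⌊n/2⌋ n)))

window₃-end : ∀ i → i + 3 ∸ 1 ≡ i + 2
window₃-end i = +-∸-assoc i {3} {1} (s≤s z≤n)

≤-window₃ : ∀ {i j} → j ≤ 2 + i → j ≤ i + 3 ∸ 1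
≤-window₃ {i} {j} j≤ = subst (j ≤_) (sym (trans (window₃-end i) (+-comm i 2))) j≤

window₃ : ∀ {i j} → i ≤ j → j ≤ i + 3 ∸ 1 → j ≡ i ⊎ j ≡ 1 + i ⊎ j ≡ 2 + i
window₃ {i} i≤j j≤end with m≤n⇒∃[o]m+o≡n i≤j
... | d , refl with +-cancelˡ-≤ i d 2 (subst (i + d ≤_) (window₃-end i) j≤end)
...   | z≤n           = inj₁ (+-identityʳ i)
...   | s≤s z≤n       = inj₂ (inj₁ (+-comm i 1))
...   | s≤s (s≤s z≤n) = inj₂ (inj₂ (+-comm i 2))

block-start : ∀ {L ℓ} t B → L ≡ 4 + 2 * t → ℓ ≡ 2 + 2 * t →
  2 + suc (B + (L + ℓ)) ≡ suc (2 * L + B)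
block-start t B refl refl = solve (t ∷ B ∷ [])

block-end : ∀ {L ℓ} t B → L ≡ 4 + 2 * t → ℓ ≡ 2 + 2 * t →
  5 + 2 * t + suc (B + (L + ℓ)) ≡ 2 * L + B + L
block-end t B refl refl = solve (t ∷ B ∷ [])

block-room : ∀ {L ℓ} t B → L ≡ 4 + 2 * t → ℓ ≡ 2 + 2 * t →
  5 + 2 * t + suc (B + (L + ℓ)) + (5 + 2 * t) + (5 + 2 * t) ≡ 2 * L + B + 3 * L + 2
block-room t B refl refl = solve (t ∷ B ∷ [])

module Minimizers {a r : Level} {A : Set a} {_≺_ : Rel A r}
  (≺-isStrictPartialOrder : IsStrictPartialOrder _≡_ _≺_) where

  open Strings _≺_
  open IsStrictPartialOrder ≺-isStrictPartialOrder using (irrefl; asym; <-resp-≈)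

  <ₗ-irrefl : ∀ {X} → ¬ X <ₗ X
  <ₗ-irrefl = <-irreflexive irrefl (Pointwise.refl refl)

  <ₗ-asym : ∀ {X Y} → X <ₗ Y → ¬ Y <ₗ X
  <ₗ-asym = <-asymmetric sym <-resp-≈ asym

  take-<ₗ⇒<ₗ : ∀ n {X Y} → take n X <ₗ take n Y → X <ₗ Y
  take-<ₗ⇒<ₗ zero    (base ())
  take-<ₗ⇒<ₗ (suc n) {[]}    {[]}    (base ())
  take-<ₗ⇒<ₗ (suc n) {[]}    {_ ∷ _} halt          = halt
  take-<ₗ⇒<ₗ (suc n) {_ ∷ _} {_ ∷ _} (this u≺v)    = this u≺v
  take-<ₗ⇒<ₗ (suc n) {_ ∷ _} {_ ∷ _} (next u≡v lt) = next u≡v (take-<ₗ⇒<ₗ n lt)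

  take-<ₗ-after-prefix : ∀ {n} C {u v X Y} → length C < n → u ≺ v →
    take n (C ++ u ∷ X) <ₗ take n (C ++ v ∷ Y)
  take-<ₗ-after-prefix {suc n} []      _           u≺v = this u≺v
  take-<ₗ-after-prefix {suc n} (c ∷ C) (s<s |C|<n) u≺v =
    next refl (take-<ₗ-after-prefix C |C|<n u≺v)

  module _ (S : List A) (k : ℕ) where
    private
      K : ℕ → List A
      K = kmer S k

    kmer-suc : ∀ n → K (suc n) ≡ take k (drop n S)
    kmer-suc n = cong (λ m → take m (drop n S)) (m+n∸m≡n n k)

    isMinimizerOf : ∀ {w i j} → i ≤ j → j ≤ i + w ∸ 1 →
      (∀ j' → i ≤ j' → j' < j → K j <ₗ K j') →
      (∀ j' → j < j' → j' ≤ i + w ∸ 1 → ¬ K j' <ₗ K j) →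
      IsMinimizerOf S w k i j
    isMinimizerOf {w} {i} {j} i≤j j≤end larger-before not-smaller-after =
      ((i≤j , j≤end) , smallest) , leftmost
      where
      smallest : ∀ j' → i ≤ j' → j' ≤ i + w ∸ 1 → ¬ K j' <ₗ K j
      smallest j' i≤j' j'≤end with <-cmp j' j
      ... | tri< j'<j _ _ = <ₗ-asym (larger-before j' i≤j' j'<j)
      ... | tri≈ _ refl _ = <ₗ-irrefl
      ... | tri> _ _ j<j' = not-smaller-after j' j<j' j'≤end

      leftmost : ∀ j' → j' < j → ¬ IsSmallest S w k i j'
      leftmost j' j'<j ((i≤j' , _) , j'-smallest) =
        j'-smallest j i≤j j≤end (larger-before j' i≤j' j'<j)

    isMinimizerOf₃-left : ∀ {i} → ¬ K (1 + i) <ₗ K i → ¬ K (2 + i) <ₗ K i →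
      IsMinimizerOf S 3 k i i
    isMinimizerOf₃-left {i} ≮₁ ≮₂ =
      isMinimizerOf ≤-refl (≤-window₃ (m≤n+m i 2))
        (λ _ i≤j' j'<i → ⊥-elim (<⇒≱ j'<i i≤j')) after
      where
      after : ∀ j' → i < j' → j' ≤ i + 3 ∸ 1 → ¬ K j' <ₗ K i
      after j' i<j' j'≤end with window₃ (<⇒≤ i<j') j'≤end
      ... | inj₁ refl        = ⊥-elim (<-irrefl refl i<j')
      ... | inj₂ (inj₁ refl) = ≮₁
      ... | inj₂ (inj₂ refl) = ≮₂

    isMinimizerOf₃-middle : ∀ {i} → K (1 + i) <ₗ K i → ¬ K (2 + i) <ₗ K (1 + i) →
      IsMinimizerOf S 3 k i (1 + i)
    isMinimizerOf₃-middle {i} <₀ ≮₂ =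
      isMinimizerOf (n≤1+n i) (≤-window₃ (n≤1+n _)) before after
      where
      before : ∀ j' → i ≤ j' → j' < 1 + i → K (1 + i) <ₗ K j'
      before j' i≤j' j'<1+i rewrite ≤-antisym (≤-pred j'<1+i) i≤j' = <₀

      after : ∀ j' → 1 + i < j' → j' ≤ i + 3 ∸ 1 → ¬ K j' <ₗ K (1 + i)
      after j' i+1<j' j'≤end with window₃ (≤-trans (n≤1+n i) (<⇒≤ i+1<j')) j'≤end
      ... | inj₁ refl        = ⊥-elim (<⇒≱ i+1<j' (n≤1+n _))
      ... | inj₂ (inj₁ refl) = ⊥-elim (<-irrefl refl i+1<j')
      ... | inj₂ (inj₂ refl) = ≮₂

    isMinimizerOf₃-right : ∀ {i} → K (2 + i) <ₗ K i → K (2 + i) <ₗ K (1 + i) →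
      IsMinimizerOf S 3 k i (2 + i)
    isMinimizerOf₃-right {i} <₀ <₁ = isMinimizerOf (m≤n+m i 2) (≤-window₃ ≤-refl) before after
      where
      before : ∀ j' → i ≤ j' → j' < 2 + i → K (2 + i) <ₗ K j'
      before j' i≤j' j'<2+i with window₃ i≤j' (≤-window₃ (<⇒≤ j'<2+i))
      ... | inj₁ refl        = <₀
      ... | inj₂ (inj₁ refl) = <₁
      ... | inj₂ (inj₂ refl) = ⊥-elim (<-irrefl refl j'<2+i)

      after : ∀ j' → 2 + i < j' → j' ≤ i + 3 ∸ 1 → ¬ K j' <ₗ K (2 + i)
      after j' i+2<j' j'≤end =
        ⊥-elim (<⇒≱ i+2<j' (subst (j' ≤_) (trans (window₃-end i) (+-comm i 2)) j'≤end))

    smaller-on-both-sides⇒¬IsSmallest : ∀ {w i a p b} → a ≤ p → p ≤ b → b ≤ w + a →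
      K a <ₗ K p → K b <ₗ K p → ¬ IsSmallest S w k i p
    smaller-on-both-sides⇒¬IsSmallest {w} {i} {a} {p} {b} a≤p p≤b b≤w+a Ka<Kp Kb<Kp
      ((i≤p , p≤end) , smallest) with i ≤? a
    ... | yes i≤a = smallest a i≤a (≤-trans a≤p p≤end) Ka<Kp
    ... | no  i≰a = smallest b (≤-trans i≤p p≤b) b≤end Kb<Kp
      where
      b≤end : b ≤ i + w ∸ 1
      b≤end = <⇒≤pred
        (≤-<-trans b≤w+a (subst (w + a <_) (+-comm w i) (+-monoʳ-< w (≰⇒> i≰a))))

    CountInRange-shift : ∀ {w c a b} (qs : List ℕ) → Unique qs →
      (∀ {q} → q ∈ qs → (a ≤ q × q ≤ b) × InMinimizers S w k (q + c)) →
      (∀ {q} → a ≤ q → q ≤ b → InMinimizers S w k (q + c) → q ∈ qs) →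
      CountInRange S w k (a + c) (b + c) (length qs)
    CountInRange-shift {w} {c} {a} {b} qs unique sound complete =
      map (_+ c) qs ,
      Unique.map⁺ (+-cancelʳ-≡ c _ _) unique ,
      (λ p → mk⇔ (listed⇒ p) (⇒listed p)) ,
      length-map _ qs
      where
      listed⇒ : ∀ p → p ∈ map (_+ c) qs → (a + c ≤ p × p ≤ b + c) × InMinimizers S w k p
      listed⇒ p p∈ with ∈-map⁻ (_+ c) p∈
      ... | q , q∈ , refl with sound q∈
      ...   | (a≤q , q≤b) , minimizer = (+-monoˡ-≤ c a≤q , +-monoˡ-≤ c q≤b) , minimizer

      ⇒listed : ∀ p → (a + c ≤ p × p ≤ b + c) × InMinimizers S w k p → p ∈ map (_+ c) qs
      ⇒listed p ((a+c≤p , p≤b+c) , minimizer)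
        with p ∸ c | m∸n+n≡m (≤-trans (m≤n+m c a) a+c≤p)
      ... | q | refl =
        ∈-map⁺ (_+ c) (complete (+-cancelʳ-≤ c a q a+c≤p) (+-cancelʳ-≤ c q b p≤b+c) minimizer)

  module Alternating (u v : A) where

    uv^ : ℕ → List A
    uv^ m = (u ∷ v ∷ []) ^^ m

    length-uv^ : ∀ m → length (uv^ m) ≡ 2 * m
    length-uv^ zero    = refl
    length-uv^ (suc m) = trans (cong (2 +_) (length-uv^ m)) (sym (*-suc 2 m))

    drop-uv^ : ∀ {j m} Y → j < m → ∃[ X ] drop (2 * j) (uv^ m ++ Y) ≡ u ∷ v ∷ X
    drop-uv^ {zero}  {suc m} Y _         = _ , refl
    drop-uv^ {suc j} {suc m} Y (s<s j<m) =
      subst (λ n → ∃[ X ] drop n (uv^ (suc m) ++ Y) ≡ u ∷ v ∷ X) (sym (*-suc 2 j)) (drop-uv^ Y j<m)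

    drop-v∷uv^ : ∀ m Y → drop (2 * m) (v ∷ uv^ m ++ Y) ≡ v ∷ Y
    drop-v∷uv^ zero    Y = refl
    drop-v∷uv^ (suc m) Y =
      trans (cong (λ n → drop n (v ∷ uv^ (suc m) ++ Y)) (*-suc 2 m)) (drop-v∷uv^ m Y)

    take-uv^-suc : ∀ m {n} Y → n ≤ 2 * m → take n (uv^ (suc m) ++ Y) ≡ take n (uv^ m ++ Y)
    take-uv^-suc m       {zero}        Y _  = refl
    take-uv^-suc zero    {suc n}       Y ()
    take-uv^-suc (suc m) {suc zero}    Y _  = refl
    take-uv^-suc (suc m) {suc (suc n)} Y n≤ = cong (λ X → u ∷ v ∷ X)
      (take-uv^-suc m Y (≤-pred (≤-pred (subst (suc (suc n) ≤_) (*-suc 2 m) n≤))))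

  module Block (x y : A) (S : List A) (M t₁ k₂ : ℕ) (Z : List A)
    (k₂<2t₁ : k₂ < 2 * t₁)
    (shape : drop M S ≡
      y ∷ y ∷ (x ∷ y ∷ []) ^^ suc t₁ ++ y ∷ y ∷ (x ∷ y ∷ []) ^^ suc t₁ ++ Z)
    (last-window-fits : 5 + 2 * t₁ + suc M ≤ length S + 2 ∸ (3 + (2 + k₂)))
    where

    open Alternating x y

    k : ℕ
    k = 2 + k₂

    -- Offset q of W is position pos q of S.  The block of the theorem is offsets
    -- 2 … 5 + 2t₁: the x's sit at 2 + 2j and the y's at 3 + 2j (j ≤ t₁), and the
    -- run y y y at 3 + 2t₁, 4 + 2t₁, 5 + 2t₁.
    W : List A
    W = y ∷ y ∷ uv^ (suc t₁) ++ y ∷ y ∷ uv^ (suc t₁) ++ Z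

    pos : ℕ → ℕ
    pos q = q + suc M

    kmerAt : ℕ → List A
    kmerAt q = kmer S k (pos q)

    kmerAt≡take : ∀ q → kmerAt q ≡ take k (drop q W)
    kmerAt≡take q = begin
      kmer S k (q + suc M)        ≡⟨ cong (kmer S k) (+-suc q M) ⟩
      kmer S k (suc (q + M))      ≡⟨ kmer-suc S k (q + M) ⟩
      take k (drop (q + M) S)     ≡⟨ cong (λ n → take k (drop n S)) (+-comm q M) ⟩
      take k (drop (M + q) S)     ≡⟨ cong (take k) (drop-drop M q S) ⟨
      take k (drop q (drop M S))  ≡⟨ cong (λ V → take k (drop q V)) shape ⟩
      take k (drop q W)           ∎
      where open ≡-Reasoning

    x-at : ∀ {j} → j ≤ t₁ → ∃[ X ] drop (2 + 2 * j) W ≡ x ∷ y ∷ X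
    x-at j≤t₁ = drop-uv^ _ (s≤s j≤t₁)

    y-after : ∀ {j} → j ≤ t₁ → ∃[ X ] drop (3 + 2 * j) W ≡ y ∷ X
    y-after {j} j≤t₁ = _ , drop-suc (2 + 2 * j) {W} (proj₂ (x-at j≤t₁))

    y-before : ∀ {j} → j ≤ t₁ → ∃[ X ] drop (1 + 2 * j) W ≡ y ∷ X
    y-before {zero}  _     = _ , refl
    y-before {suc j} j<t₁ =
      subst (λ n → ∃[ X ] drop (1 + n) W ≡ y ∷ X) (sym (*-suc 2 j)) (y-after (<⇒≤ j<t₁))

    x-at-next : ∀ {j} → j < t₁ → ∃[ X ] drop (4 + 2 * j) W ≡ x ∷ X
    x-at-next {j} j<t₁ =
      subst (λ n → ∃[ X ] drop (2 + n) W ≡ x ∷ X) (*-suc 2 j) (_ , proj₂ (x-at j<t₁))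

    yyy-run : drop (3 + 2 * t₁) W ≡ y ∷ y ∷ y ∷ uv^ (suc t₁) ++ Z
    yyy-run = drop-v∷uv^ t₁ _

    after-yyy-run : ∀ d → drop (d + (3 + 2 * t₁)) W ≡ drop d (y ∷ y ∷ y ∷ uv^ (suc t₁) ++ Z)
    after-yyy-run d = drop-+ d {3 + 2 * t₁} {W} yyy-run

    kmerAt-period : kmerAt (7 + 2 * t₁) ≡ kmerAt (5 + 2 * t₁)
    kmerAt-period = begin
      kmerAt (7 + 2 * t₁)                    ≡⟨ kmerAt≡take (7 + 2 * t₁) ⟩
      take k (drop (7 + 2 * t₁) W)           ≡⟨ cong (take k) (after-yyy-run 4) ⟩
      y ∷ take (suc k₂) (uv^ t₁ ++ Z)        ≡⟨ cong (y ∷_) (take-uv^-suc t₁ Z k₂<2t₁) ⟨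
      y ∷ take (suc k₂) (uv^ (suc t₁) ++ Z)  ≡⟨ cong (take k) (after-yyy-run 2) ⟨
      take k (drop (5 + 2 * t₁) W)           ≡⟨ kmerAt≡take (5 + 2 * t₁) ⟨
      kmerAt (5 + 2 * t₁)                    ∎
      where open ≡-Reasoning

    kmerAt-< : ∀ q q' C {u v X Y} → drop q W ≡ C ++ u ∷ X → drop q' W ≡ C ++ v ∷ Y →
      length C < k → u ≺ v → kmerAt q <ₗ kmerAt q'
    kmerAt-< q q' C eq eq' |C|<k u≺v
      rewrite kmerAt≡take q | kmerAt≡take q' | eq | eq' = take-<ₗ-after-prefix C |C|<k u≺v

    kmerAt-<₁ : ∀ q q' {u v X Y} → drop q W ≡ u ∷ X → drop q' W ≡ v ∷ Y →
      u ≺ v → kmerAt q <ₗ kmerAt q'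
    kmerAt-<₁ q q' eq eq' = kmerAt-< q q' [] eq eq' z<s

    kmerAt-<₂ : ∀ q q' {c u v X Y} → drop q W ≡ c ∷ u ∷ X → drop q' W ≡ c ∷ v ∷ Y →
      u ≺ v → kmerAt q <ₗ kmerAt q'
    kmerAt-<₂ q q' {c} eq eq' = kmerAt-< q q' (c ∷ []) eq eq' (s<s z<s)

    kmerAt-≮ : ∀ q q' {X Y} → drop q W ≡ X → drop q' W ≡ Y →
      X <ₗ Y → ¬ kmerAt q' <ₗ kmerAt q
    kmerAt-≮ q q' eq eq' X<Y
      rewrite kmerAt≡take q | kmerAt≡take q' | eq | eq' = <ₗ-asym X<Y ∘ take-<ₗ⇒<ₗ k

    inMinimizers : ∀ {q' p} → q' ≤ 5 + 2 * t₁ → IsMinimizerOf S 3 k (pos q') p →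
      InMinimizers S 3 k p
    inMinimizers {q'} q'≤ minimizer =
      pos q' ,
      (≤-trans (s≤s z≤n) (m≤n+m (suc M) q') ,
       ≤-trans (+-monoˡ-≤ (suc M) q'≤) last-window-fits) ,
      minimizer

    smaller-on-both-sides⇒¬InMinimizers : ∀ {a q b} → a ≤ q → q ≤ b → b ≤ 3 + a →
      kmerAt a <ₗ kmerAt q → kmerAt b <ₗ kmerAt q → ¬ InMinimizers S 3 k (pos q)
    smaller-on-both-sides⇒¬InMinimizers a≤q q≤b b≤3+a Ka<Kq Kb<Kq (_ , _ , smallest , _) =
      smaller-on-both-sides⇒¬IsSmallest S k
        (+-monoˡ-≤ (suc M) a≤q) (+-monoˡ-≤ (suc M) q≤b) (+-monoˡ-≤ (suc M) b≤3+a)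
        Ka<Kq Kb<Kq smallest

    module When-x≺y (x≺y : x ≺ y) where

      x-isMinimizer : ∀ {j} → j ≤ t₁ → IsMinimizerOf S 3 k (pos (1 + 2 * j)) (pos (2 + 2 * j))
      x-isMinimizer {j} j≤t₁ = isMinimizerOf₃-middle S k {pos (1 + 2 * j)}
        (kmerAt-<₁ (2 + 2 * j) (1 + 2 * j) (proj₂ (x-at j≤t₁)) (proj₂ (y-before j≤t₁)) x≺y)
        (kmerAt-≮ (2 + 2 * j) (3 + 2 * j)
          (proj₂ (x-at j≤t₁)) (proj₂ (y-after j≤t₁)) (this x≺y))

      run₂-isMinimizer : IsMinimizerOf S 3 k (pos (3 + 2 * t₁)) (pos (5 + 2 * t₁))
      run₂-isMinimizer = isMinimizerOf₃-right S k {pos (3 + 2 * t₁)}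
        (kmerAt-<₂ (5 + 2 * t₁) (3 + 2 * t₁) (after-yyy-run 2) yyy-run x≺y)
        (kmerAt-<₂ (5 + 2 * t₁) (4 + 2 * t₁) (after-yyy-run 2) (after-yyy-run 1) x≺y)

      y-not-minimizer : ∀ {j} → j < t₁ → ¬ InMinimizers S 3 k (pos (3 + 2 * j))
      y-not-minimizer {j} j<t₁ =
        smaller-on-both-sides⇒¬InMinimizers {2 + 2 * j} {3 + 2 * j} {4 + 2 * j}
          (n≤1+n _) (n≤1+n _) (n≤1+n _)
          (kmerAt-<₁ (2 + 2 * j) (3 + 2 * j)
            (proj₂ (x-at (<⇒≤ j<t₁))) (proj₂ (y-after (<⇒≤ j<t₁))) x≺y)
          (kmerAt-<₁ (4 + 2 * j) (3 + 2 * j)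
            (proj₂ (x-at-next j<t₁)) (proj₂ (y-after (<⇒≤ j<t₁))) x≺y)

      run₀-not-minimizer : ¬ InMinimizers S 3 k (pos (3 + 2 * t₁))
      run₀-not-minimizer =
        smaller-on-both-sides⇒¬InMinimizers {2 + 2 * t₁} {3 + 2 * t₁} {5 + 2 * t₁}
          (n≤1+n _) (m≤n+m _ 2) ≤-refl
          (kmerAt-<₁ (2 + 2 * t₁) (3 + 2 * t₁) (proj₂ (x-at ≤-refl)) yyy-run x≺y)
          (kmerAt-<₂ (5 + 2 * t₁) (3 + 2 * t₁) (after-yyy-run 2) yyy-run x≺y)

      run₁-not-minimizer : ¬ InMinimizers S 3 k (pos (4 + 2 * t₁))
      run₁-not-minimizer =
        smaller-on-both-sides⇒¬InMinimizers {2 + 2 * t₁} {4 + 2 * t₁} {5 + 2 * t₁}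
          (m≤n+m _ 2) (n≤1+n _) ≤-refl
          (kmerAt-<₁ (2 + 2 * t₁) (4 + 2 * t₁) (proj₂ (x-at ≤-refl)) (after-yyy-run 1) x≺y)
          (kmerAt-<₂ (5 + 2 * t₁) (4 + 2 * t₁) (after-yyy-run 2) (after-yyy-run 1) x≺y)

      x-offset : ℕ → ℕ
      x-offset j = 2 + 2 * j

      offsets : List ℕ
      offsets = 5 + 2 * t₁ ∷ applyUpTo x-offset (suc t₁)

      unique : Unique offsets
      unique =
        Allₚ.applyUpTo⁺₁ x-offset _
          (λ { (s≤s j≤t₁) → >⇒≢ (+-mono-<-≤ (m≤m+n 3 2) (*-monoʳ-≤ 2 j≤t₁)) })
        AllPairs.∷
        Unique.applyUpTo⁺₁ x-offset _ (λ i<j _ → <⇒≢ (+-monoʳ-< 2 (*-monoʳ-< 2 i<j)))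

      sound : ∀ {q} → q ∈ offsets → (2 ≤ q × q ≤ 5 + 2 * t₁) × InMinimizers S 3 k (pos q)
      sound (here refl) = (m≤m+n 2 _ , ≤-refl) , inMinimizers (m≤n+m _ 2) run₂-isMinimizer
      sound (there q∈) with ∈-applyUpTo⁻ x-offset q∈
      ... | j , s≤s j≤t₁ , refl =
        (m≤m+n 2 _ , +-mono-≤ (m≤m+n 2 3) (*-monoʳ-≤ 2 j≤t₁)) ,
        inMinimizers (+-mono-≤ (m≤m+n 1 4) (*-monoʳ-≤ 2 j≤t₁)) (x-isMinimizer j≤t₁)

      complete : ∀ {q} → 2 ≤ q → q ≤ 5 + 2 * t₁ → InMinimizers S 3 k (pos q) → q ∈ offsets
      complete {suc (suc n)} (s≤s (s≤s _)) q≤ minimizer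
        with ≤3+2*t-cases t₁ n (≤-pred (≤-pred q≤))
      ... | inj₁ (j , j≤t₁ , refl) = there (∈-applyUpTo⁺ x-offset (s≤s j≤t₁))
      ... | inj₂ (inj₁ (j , j≤t₁ , refl)) with m≤n⇒m<n∨m≡n j≤t₁
      ...   | inj₁ j<t₁ = ⊥-elim (y-not-minimizer j<t₁ minimizer)
      ...   | inj₂ refl = ⊥-elim (run₀-not-minimizer minimizer)
      complete _ _ minimizer | inj₂ (inj₂ (inj₁ refl)) = ⊥-elim (run₁-not-minimizer minimizer)
      complete _ _ minimizer | inj₂ (inj₂ (inj₂ refl)) = here refl

      count : CountInRange S 3 k (pos 2) (pos (5 + 2 * t₁)) (2 + t₁)
      count = subst (CountInRange S 3 k (pos 2) (pos (5 + 2 * t₁)))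
        (cong suc (length-applyUpTo x-offset (suc t₁)))
        (CountInRange-shift S k offsets unique sound complete)

    module When-y≺x (y≺x : y ≺ x) where

      y-next-not-smaller : ∀ {j} → j ≤ t₁ → ¬ kmerAt (4 + 2 * j) <ₗ kmerAt (3 + 2 * j)
      y-next-not-smaller {j} j≤t₁ with m≤n⇒m<n∨m≡n j≤t₁
      ... | inj₁ j<t₁ = kmerAt-≮ (3 + 2 * j) (4 + 2 * j)
        (proj₂ (y-after j≤t₁)) (proj₂ (x-at-next j<t₁)) (this y≺x)
      ... | inj₂ refl = kmerAt-≮ (3 + 2 * t₁) (4 + 2 * t₁)
        yyy-run (after-yyy-run 1) (next refl (next refl (this y≺x)))

      y-isMinimizer : ∀ {j} → j ≤ t₁ → IsMinimizerOf S 3 k (pos (2 + 2 * j)) (pos (3 + 2 * j))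
      y-isMinimizer {j} j≤t₁ = isMinimizerOf₃-middle S k {pos (2 + 2 * j)}
        (kmerAt-<₁ (3 + 2 * j) (2 + 2 * j) (proj₂ (y-after j≤t₁)) (proj₂ (x-at j≤t₁)) y≺x)
        (y-next-not-smaller j≤t₁)

      run₁-isMinimizer : IsMinimizerOf S 3 k (pos (4 + 2 * t₁)) (pos (4 + 2 * t₁))
      run₁-isMinimizer = isMinimizerOf₃-left S k {pos (4 + 2 * t₁)}
        (kmerAt-≮ (4 + 2 * t₁) (5 + 2 * t₁)
          (after-yyy-run 1) (after-yyy-run 2) (next refl (this y≺x)))
        (kmerAt-≮ (4 + 2 * t₁) (6 + 2 * t₁) (after-yyy-run 1) (after-yyy-run 3) (this y≺x))

      run₂-isMinimizer : IsMinimizerOf S 3 k (pos (5 + 2 * t₁)) (pos (5 + 2 * t₁))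
      run₂-isMinimizer = isMinimizerOf₃-left S k {pos (5 + 2 * t₁)}
        (kmerAt-≮ (5 + 2 * t₁) (6 + 2 * t₁) (after-yyy-run 2) (after-yyy-run 3) (this y≺x))
        (<ₗ-irrefl ∘ subst (_<ₗ kmerAt (5 + 2 * t₁)) kmerAt-period)

      x-not-minimizer : ∀ {j} → j ≤ t₁ → ¬ InMinimizers S 3 k (pos (2 + 2 * j))
      x-not-minimizer {j} j≤t₁ =
        smaller-on-both-sides⇒¬InMinimizers {1 + 2 * j} {2 + 2 * j} {3 + 2 * j}
          (n≤1+n _) (n≤1+n _) (n≤1+n _)
          (kmerAt-<₁ (1 + 2 * j) (2 + 2 * j) (proj₂ (y-before j≤t₁)) (proj₂ (x-at j≤t₁)) y≺x)
          (kmerAt-<₁ (3 + 2 * j) (2 + 2 * j) (proj₂ (y-after j≤t₁)) (proj₂ (x-at j≤t₁)) y≺x)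

      y-offset : ℕ → ℕ
      y-offset j = 3 + 2 * j

      offsets : List ℕ
      offsets = 4 + 2 * t₁ ∷ 5 + 2 * t₁ ∷ applyUpTo y-offset (suc t₁)

      unique : Unique offsets
      unique =
        (<⇒≢ (n<1+n _) All.∷ Allₚ.applyUpTo⁺₁ y-offset _
          (λ { (s≤s j≤t₁) → >⇒≢ (+-mono-<-≤ (n<1+n 3) (*-monoʳ-≤ 2 j≤t₁)) }))
        AllPairs.∷
        Allₚ.applyUpTo⁺₁ y-offset _
          (λ { (s≤s j≤t₁) → >⇒≢ (+-mono-<-≤ (m≤m+n 4 1) (*-monoʳ-≤ 2 j≤t₁)) })
        AllPairs.∷
        Unique.applyUpTo⁺₁ y-offset _ (λ i<j _ → <⇒≢ (+-monoʳ-< 3 (*-monoʳ-< 2 i<j)))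

      sound : ∀ {q} → q ∈ offsets → (2 ≤ q × q ≤ 5 + 2 * t₁) × InMinimizers S 3 k (pos q)
      sound (here refl)         = (m≤m+n 2 _ , n≤1+n _) , inMinimizers (n≤1+n _) run₁-isMinimizer
      sound (there (here refl)) = (m≤m+n 2 _ , ≤-refl) , inMinimizers ≤-refl run₂-isMinimizer
      sound (there (there q∈)) with ∈-applyUpTo⁻ y-offset q∈
      ... | j , s≤s j≤t₁ , refl =
        (m≤m+n 2 _ , +-mono-≤ (m≤m+n 3 2) (*-monoʳ-≤ 2 j≤t₁)) ,
        inMinimizers (+-mono-≤ (m≤m+n 2 3) (*-monoʳ-≤ 2 j≤t₁)) (y-isMinimizer j≤t₁)

      complete : ∀ {q} → 2 ≤ q → q ≤ 5 + 2 * t₁ → InMinimizers S 3 k (pos q) → q ∈ offsets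
      complete {suc (suc n)} (s≤s (s≤s _)) q≤ minimizer
        with ≤3+2*t-cases t₁ n (≤-pred (≤-pred q≤))
      ... | inj₁ (j , j≤t₁ , refl)         = ⊥-elim (x-not-minimizer j≤t₁ minimizer)
      ... | inj₂ (inj₁ (j , j≤t₁ , refl)) = there (there (∈-applyUpTo⁺ y-offset (s≤s j≤t₁)))
      ... | inj₂ (inj₂ (inj₁ refl))       = here refl
      ... | inj₂ (inj₂ (inj₂ refl))       = there (here refl)

      count : CountInRange S 3 k (pos 2) (pos (5 + 2 * t₁)) (3 + t₁)
      count = subst (CountInRange S 3 k (pos 2) (pos (5 + 2 * t₁)))
        (cong (2 +_) (length-applyUpTo y-offset (suc t₁)))
        (CountInRange-shift S k offsets unique sound complete)

  module Tiling (x y : A) (t₁ : ℕ) where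

    open Alternating x y

    T : List A
    T = uv^ (suc t₁) ++ y ∷ y ∷ []

    |uv^| : length (uv^ (suc t₁)) ≡ 2 + 2 * t₁
    |uv^| = trans (length-uv^ (suc t₁)) (*-suc 2 t₁)

    |T| : length T ≡ 4 + 2 * t₁
    |T| = trans (length-++ (uv^ (suc t₁))) (trans (cong (_+ 2) |uv^|) (+-comm (2 + 2 * t₁) 2))

    T^^suc++ : ∀ m X → T ^^ suc m ++ X ≡ uv^ (suc t₁) ++ y ∷ y ∷ T ^^ m ++ X
    T^^suc++ m X = trans (++-assoc T (T ^^ m) X) (++-assoc (uv^ (suc t₁)) (y ∷ y ∷ []) _)

    T⁵-shape : ∀ {S n} B → take n (drop B S) ≡ T ^^ 5 →
      drop (B + (length T + length (uv^ (suc t₁)))) S ≡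
        y ∷ y ∷ uv^ (suc t₁) ++ y ∷ y ∷ uv^ (suc t₁) ++ y ∷ y ∷ T ^^ 1 ++ drop n (drop B S)
    T⁵-shape {S} {n} B eq = begin
      drop (B + (L + ℓ)) S                         ≡⟨ drop-drop B (L + ℓ) S ⟨
      drop (L + ℓ) (drop B S)                      ≡⟨ drop-drop L ℓ (drop B S) ⟨
      drop ℓ (drop L (drop B S))
        ≡⟨ cong (drop ℓ ∘ drop L) (take≡⇒≡++drop n eq) ⟩
      drop ℓ (drop L (T ^^ 5 ++ R))
        ≡⟨ cong (drop ℓ ∘ drop L) (++-assoc T (T ^^ 4) R) ⟩
      drop ℓ (drop L (T ++ T ^^ 4 ++ R))           ≡⟨ cong (drop ℓ) (drop-length-++ T) ⟩
      drop ℓ (T ^^ 4 ++ R)                         ≡⟨ cong (drop ℓ) (T^^suc++ 3 R) ⟩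
      drop ℓ (uv^ (suc t₁) ++ y ∷ y ∷ T ^^ 3 ++ R) ≡⟨ drop-length-++ (uv^ (suc t₁)) ⟩
      y ∷ y ∷ T ^^ 3 ++ R                          ≡⟨ cong (λ V → y ∷ y ∷ V) (T^^suc++ 2 R) ⟩
      y ∷ y ∷ uv^ (suc t₁) ++ y ∷ y ∷ T ^^ 2 ++ R
        ≡⟨ cong (λ V → y ∷ y ∷ uv^ (suc t₁) ++ y ∷ y ∷ V) (T^^suc++ 1 R) ⟩
      y ∷ y ∷ uv^ (suc t₁) ++ y ∷ y ∷ uv^ (suc t₁) ++ y ∷ y ∷ T ^^ 1 ++ R ∎
      where
      open ≡-Reasoning
      L ℓ : ℕ
      L = length T
      ℓ = length (uv^ (suc t₁))
      R : List A
      R = drop n (drop B S)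

    T⁵-counts : ∀ k₂ → k₂ < 2 * t₁ → ∀ S B →
      let L = length T
          s = suc (2 * L + B)
      in s + 3 * L ∸ 1 ≤ length S →
         frag S (s ∸ 2 * L) (s + 3 * L ∸ 1) ≡ T ^^ 5 →
         (x ≺ y → CountInRange S 3 (2 + k₂) s (s + L ∸ 1) (2 + t₁)) ×
         (y ≺ x → CountInRange S 3 (2 + k₂) s (s + L ∸ 1) (3 + t₁))
    T⁵-counts k₂ k₂<2t₁ S B S-long T⁵ =
      relocate ∘ When-x≺y.count , relocate ∘ When-y≺x.count
      where
      L : ℕ
      L = length T

      M : ℕ
      M = B + (L + length (uv^ (suc t₁)))

      T⁵-at-suc-B : frag S (suc B) (suc (2 * L + B) + 3 * L ∸ 1) ≡ T ^^ 5
      T⁵-at-suc-B = subst (λ i → frag S i (suc (2 * L + B) + 3 * L ∸ 1) ≡ T ^^ 5)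
        (trans (+-∸-assoc 1 (m≤m+n (2 * L) B)) (cong suc (m+n∸m≡n (2 * L) B))) T⁵

      room : 5 + 2 * t₁ + suc M ≤ length S + 2 ∸ (3 + (2 + k₂))
      room = m+n≤o⇒m≤o∸n _ (begin
        5 + 2 * t₁ + suc M + (5 + k₂)
          ≤⟨ +-monoʳ-≤ (5 + 2 * t₁ + suc M) (+-monoʳ-≤ 5 (<⇒≤ k₂<2t₁)) ⟩
        5 + 2 * t₁ + suc M + (5 + 2 * t₁)
          ≤⟨ m≤m+n _ (5 + 2 * t₁) ⟩
        5 + 2 * t₁ + suc M + (5 + 2 * t₁) + (5 + 2 * t₁)
          ≡⟨ block-room t₁ B |T| |uv^| ⟩
        2 * L + B + 3 * L + 2
          ≤⟨ +-monoˡ-≤ 2 S-long ⟩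
        length S + 2 ∎)
        where open ≤-Reasoning

      open Block x y S M t₁ k₂ _ k₂<2t₁ (T⁵-shape B T⁵-at-suc-B) room

      relocate : ∀ {c} → CountInRange S 3 k (pos 2) (pos (5 + 2 * t₁)) c →
        CountInRange S 3 k (suc (2 * L + B)) (suc (2 * L + B) + L ∸ 1) c
      relocate {c} = subst₂ (λ l r → CountInRange S 3 k l r c)
        (block-start t₁ B |T| |uv^|) (block-end t₁ B |T| |uv^|)

lemma9 : ∀ {a ℓ : Level} {A : Set a} {_≺_ : Rel A ℓ} →
    IsStrictTotalOrder _≡_ _≺_ →
    (k : ℕ) → 2 ≤ k →
    (x y : A) → ¬ (x ≡ y) →
    (S : List A) (s : ℕ) →
    let open Strings _≺_
        w = 3
        t = ⌈ (w + k) /2⌉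
        T = ((x ∷ y ∷ []) ^^ t) ++ (y ∷ y ∷ [])
        L = length T
    in 2 * L < s →
       s + 3 * L ∸ 1 ≤ length S →
       frag S (s ∸ 2 * L) (s + 3 * L ∸ 1) ≡ T ^^ 5 →
       (x ≺ y → CountInRange S w k s (s + L ∸ 1) (⌊ k /2⌋ + 3)) ×
       (y ≺ x → CountInRange S w k s (s + L ∸ 1) (⌊ k /2⌋ + 4))
-- The hypothesis x ≢ y is implied by either of x ≺ y and y ≺ x.
lemma9 _ zero () _ _ _ _ _ _ _ _
lemma9 _ (suc zero) (s≤s ()) _ _ _ _ _ _ _ _
lemma9 {_≺_ = _≺_} sto (suc (suc k₂)) _ x y _ S s 2L<s S-long T⁵ with m≤n⇒∃[o]m+o≡n 2L<s
... | B , refl =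
  Product.map (subst count-in-block (+-comm 3 (suc ⌊ k₂ /2⌋)) ∘_)
              (subst count-in-block (+-comm 4 (suc ⌊ k₂ /2⌋)) ∘_)
              (T⁵-counts k₂ k₂<2t₁ S B S-long T⁵)
  where
  open Strings _≺_ using (CountInRange)
  open Minimizers.Tiling (IsStrictTotalOrder.isStrictPartialOrder sto) x y (2 + ⌊ k₂ /2⌋)

  count-in-block : ℕ → Set _
  count-in-block = CountInRange S 3 (2 + k₂) s (s + length T ∸ 1)

  k₂<2t₁ : k₂ < 2 * (2 + ⌊ k₂ /2⌋)
  k₂<2t₁ = <-≤-trans (n<2*suc⌊n/2⌋ k₂) (*-monoʳ-≤ 2 (n≤1+n (suc ⌊ k₂ /2⌋)))
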